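{- For non-negative integers $n$ and $\ell$, and real number $r$, $$B_{n+\ell,r}(x)=\sum_{j=0}^{\ell}\sum_{k=0}^n\left\{ {\ell+r \atop j+r} \right\}_r\binom{n}{k}j^{n-k}B_{k,r}(x)\,x^j$$ and $$B_{n+\ell,r}=\sum_{j=0}^{\ell}\sum_{k=0}^n\left\{ {\ell+r \atop j+r} \right\}_r\binom{n}{k}j^{n-k}B_{k,r}.$$
   Context: For real $r$ and integers $n,k\ge0$, the $r$-Stirling numbers of the second kind $\left\{ {n+r \atop k+r} \right\}_r$ are the coefficients in $(t+r)^n=\sum_{k=0}^n\left\{ {n+r \atop k+r} \right\}_r(t)_k$, where $(t)_k=t(t-1)\cdots(t-k+1)$ (equivalently: value $1$ at $n=k=0$, zero for $k>n$ or $k<0$, and $\left\{ {n+r \atop k+r} \right\}_r=\left\{ {n-1+r \atop k-1+r} \right\}_r+(k+r)\left\{ {n-1+r \atop k+r} \right\}_r$). The $r$-Bell polynomials are $B_{n,r}(x)=\sum_{k=0}^n\left\{ {n+r \atop k+r} \right\}_rx^k$ and the $r$-Bell numbers are $B_{n,r}=B_{n,r}(1)$. The convention $0^0=1$ is used. -}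

module Defs where

open import Level using (Level)
open import Data.Nat as ℕ using (ℕ; zero; suc)
open import Data.Nat.Combinatorics using (_C_)
open import Algebra.Bundles using (CommutativeRing; Semiring)
import Algebra.Definitions.RawSemiring as RawSemiringDefs

module RBell {c ℓ : Level} (R : CommutativeRing c ℓ) where
  open CommutativeRing R hiding (zero)
  open RawSemiringDefs (Semiring.rawSemiring semiring) using (_×_)
  open RawSemiringDefs (Semiring.rawSemiring semiring) public using (_^_)

  ⟦_⟧ : ℕ → Carrier
  ⟦ k ⟧ = k × 1#

  sumTo : ℕ → (ℕ → Carrier) → Carrier
  sumTo zero    f = f 0
  sumTo (suc n) f = sumTo n f + f (suc n)

  -- rStirling r n k  stands for  { n+r \atop k+r }_r
  rStirling : Carrier → ℕ → ℕ → Carrier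
  rStirling r zero    zero    = 1#
  rStirling r zero    (suc k) = 0#
  rStirling r (suc n) zero    = (⟦ 0 ⟧ + r) * rStirling r n zero
  rStirling r (suc n) (suc k) =
    rStirling r n k + (⟦ suc k ⟧ + r) * rStirling r n (suc k)

  rBellPoly : ℕ → Carrier → Carrier → Carrier
  rBellPoly n r x = sumTo n (λ k → rStirling r n k * (x ^ k))

  rBell : ℕ → Carrier → Carrier
  rBell n r = rBellPoly n r 1#

  binom : ℕ → ℕ → Carrier
  binom n k = ⟦ n C k ⟧

  -- j^(n-k) with j viewed in R (0^0 = 1 as ^ is defined with x^0 = 1)
  natPow : ℕ → ℕ → Carrier
  natPow j m = ⟦ j ⟧ ^ m

module Submission where

-- The argument rests on two recurrences for the r-Bell polynomials.
--  (1) Shifting the parameter:  B_{n+1,s}(x) = x B_{n,s+1}(x) + s B_{n,s}(x),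
--      which follows from the Stirling recurrence
--      {n+1+s, m+1+s}_s = {n+s+1, m+s+1}_{s+1} + s {n+s, m+1+s}_s.
--  (2) From (1) and Pascal's rule, by induction on n, the binomial shift
--      B_{n,s+t}(x) = Σ_k C(n,k) t^(n-k) B_{k,s}(x).
-- Applying (1) l times along the defining recurrence of the Stirling numbers
-- gives the expansion  B_{n+l,r}(x) = Σ_j {l+r, j+r}_r x^j B_{n,r+j}(x);
-- substituting (2) with t = j into each summand yields the theorem.

open import Defs
open import Level using (Level)
open import Data.Nat using (ℕ)
import Data.Nat as ℕ
import Data.Product as P
open import Algebra.Bundles using (CommutativeRing)

open import Data.Nat using (zero; suc; z≤n)
import Data.Nat.Properties as NP
open import Data.Nat.Combinatorics using (_C_; nCk+nC[k+1]≡[n+1]C[k+1]; k>n⇒nCk≡0)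
open import Relation.Binary.PropositionalEquality as PE using (_≡_)

module RBellIdentities {c ℓ : Level} (R : CommutativeRing c ℓ) where
  open CommutativeRing R hiding (zero)
  open RBell R
  open import Relation.Binary.Reasoning.Setoid setoid
  open import Algebra.Solver.Ring.NaturalCoefficients.Default commutativeSemiring
    using (solve; _:=_; _:+_; _:*_)

  sumTo-cong : ∀ n {f g : ℕ → Carrier} →
    (∀ k → k ℕ.≤ n → f k ≈ g k) → sumTo n f ≈ sumTo n g
  sumTo-cong zero    f≈g = f≈g 0 z≤n
  sumTo-cong (suc n) f≈g =
    +-cong (sumTo-cong n (λ k k≤n → f≈g k (NP.m≤n⇒m≤1+n k≤n))) (f≈g (suc n) NP.≤-refl)

  sumTo-cong′ : ∀ n {f g : ℕ → Carrier} → (∀ k → f k ≈ g k) → sumTo n f ≈ sumTo n g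
  sumTo-cong′ n f≈g = sumTo-cong n (λ k _ → f≈g k)

  sumTo-+ : ∀ n (f g : ℕ → Carrier) →
    sumTo n (λ k → f k + g k) ≈ sumTo n f + sumTo n g
  sumTo-+ zero    f g = refl
  sumTo-+ (suc n) f g = trans (+-cong (sumTo-+ n f g) refl)
    (solve 4 (λ a b c d → ((a :+ b) :+ (c :+ d)) := ((a :+ c) :+ (b :+ d))) refl _ _ _ _)

  sumTo-*ˡ : ∀ n a (f : ℕ → Carrier) → sumTo n (λ k → a * f k) ≈ a * sumTo n f
  sumTo-*ˡ zero    a f = refl
  sumTo-*ˡ (suc n) a f = trans (+-cong (sumTo-*ˡ n a f) refl) (sym (distribˡ a _ _))

  sumTo-linear : ∀ n a b (f g : ℕ → Carrier) →
    sumTo n (λ k → a * f k + b * g k) ≈ a * sumTo n f + b * sumTo n g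
  sumTo-linear n a b f g = trans (sumTo-+ n _ _) (+-cong (sumTo-*ˡ n a f) (sumTo-*ˡ n b g))

  sumTo-peel : ∀ n (f : ℕ → Carrier) → sumTo (suc n) f ≈ f 0 + sumTo n (λ k → f (suc k))
  sumTo-peel zero    f = refl
  sumTo-peel (suc n) f = trans (+-cong (sumTo-peel n f) refl) (+-assoc _ _ _)

  sumTo-dropLast : ∀ n (f : ℕ → Carrier) → f (suc n) ≈ 0# → sumTo (suc n) f ≈ sumTo n f
  sumTo-dropLast n f last≈0 = trans (+-cong refl last≈0) (+-identityʳ _)

  ⟦+⟧ : ∀ a b → ⟦ a ℕ.+ b ⟧ ≈ ⟦ a ⟧ + ⟦ b ⟧
  ⟦+⟧ zero    b = sym (+-identityˡ _)
  ⟦+⟧ (suc a) b = trans (+-cong refl (⟦+⟧ a b)) (sym (+-assoc _ _ _))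

  ⟦≡⟧ : ∀ {a b} → a ≡ b → ⟦ a ⟧ ≈ ⟦ b ⟧
  ⟦≡⟧ PE.refl = refl

  private
    S : Carrier → ℕ → ℕ → Carrier
    S = rStirling

  rStirling-cong : ∀ {s t} → s ≈ t → ∀ n m → S s n m ≈ S t n m
  rStirling-cong s≈t zero    zero    = refl
  rStirling-cong s≈t zero    (suc m) = refl
  rStirling-cong s≈t (suc n) zero    =
    *-cong (+-cong refl s≈t) (rStirling-cong s≈t n zero)
  rStirling-cong s≈t (suc n) (suc m) =
    +-cong (rStirling-cong s≈t n m) (*-cong (+-cong refl s≈t) (rStirling-cong s≈t n (suc m)))

  rStirling-vanish : ∀ s n m → n ℕ.< m → S s n m ≈ 0#
  rStirling-vanish s zero    (suc m) _ = refl
  rStirling-vanish s (suc n) (suc m) (ℕ.s≤s n<m) =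
    trans (+-cong (rStirling-vanish s n m n<m)
                  (*-cong refl (rStirling-vanish s n (suc m) (NP.m<n⇒m<1+n n<m))))
          (trans (+-identityˡ _) (zeroʳ _))

  -- Trading one unit of the parameter for one step of the recurrence:
  -- {n+1+s, m+1+s}_s = {n+(s+1), m+(s+1)}_{s+1} + s {n+s, m+1+s}_s.
  rStirling-shift : ∀ s n m → S s (suc n) (suc m) ≈ S (s + 1#) n m + s * S s n (suc m)
  rStirling-shift s zero zero    = +-cong refl (trans (zeroʳ _) (sym (zeroʳ _)))
  rStirling-shift s zero (suc m) = +-cong refl (trans (zeroʳ _) (sym (zeroʳ _)))
  rStirling-shift s (suc n) zero = begin
      (0# + s) * S s n 0 + ((1# + 0#) + s) * S s (suc n) 1
    ≈⟨ +-cong (*-cong (+-identityˡ s) refl)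
              (*-cong (+-cong (+-identityʳ 1#) refl) (rStirling-shift s n 0)) ⟩
      s * S s n 0 + (1# + s) * (S (s + 1#) n 0 + s * S s n 1)
    ≈⟨ solve 5 (λ u s a₀ a₁ b₀ →
         (s :* a₀ :+ (u :+ s) :* (b₀ :+ s :* a₁))
         := ((s :+ u) :* b₀ :+ s :* (a₀ :+ (u :+ s) :* a₁)))
         refl 1# s (S s n 0) (S s n 1) (S (s + 1#) n 0) ⟩
      (s + 1#) * S (s + 1#) n 0 + s * (S s n 0 + (1# + s) * S s n 1)
    ≈⟨ +-cong (*-cong (+-identityˡ _) refl)
              (*-cong refl (+-cong refl (*-cong (+-cong (+-identityʳ 1#) refl) refl))) ⟨
      (0# + (s + 1#)) * S (s + 1#) n 0 + s * (S s n 0 + ((1# + 0#) + s) * S s n 1)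
    ∎
  rStirling-shift s (suc n) (suc m) = begin
      S s (suc n) (suc m) + ((1# + K) + s) * S s (suc n) (suc (suc m))
    ≈⟨ +-cong (rStirling-shift s n m) (*-cong refl (rStirling-shift s n (suc m))) ⟩
      (S (s + 1#) n m + s * S s n (suc m))
        + ((1# + K) + s) * (S (s + 1#) n (suc m) + s * S s n (suc (suc m)))
    ≈⟨ solve 7 (λ u s k b₀ b₁ a₁ a₂ →
         ((b₀ :+ s :* a₁) :+ ((u :+ k) :+ s) :* (b₁ :+ s :* a₂))
         := ((b₀ :+ (k :+ (s :+ u)) :* b₁) :+ s :* (a₁ :+ ((u :+ k) :+ s) :* a₂)))
         refl 1# s K (S (s + 1#) n m) (S (s + 1#) n (suc m)) (S s n (suc m)) (S s n (suc (suc m))) ⟩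
      (S (s + 1#) n m + (K + (s + 1#)) * S (s + 1#) n (suc m))
        + s * (S s n (suc m) + ((1# + K) + s) * S s n (suc (suc m)))
    ∎
    where K = ⟦ suc m ⟧

  binomialSum : Carrier → ℕ → (ℕ → Carrier) → Carrier
  binomialSum t n f = sumTo n (λ k → binom n k * t ^ (n ℕ.∸ k) * f k)

  -- Pascal's rule for binomial sums:
  -- Σ C(n+1,k) t^(n+1-k) f(k) = t Σ C(n,k) t^(n-k) f(k) + Σ C(n,k) t^(n-k) f(k+1).
  binomialSum-suc : ∀ t n (f : ℕ → Carrier) →
    binomialSum t (suc n) f ≈ t * binomialSum t n f + binomialSum t n (λ k → f (suc k))
  binomialSum-suc t n f = begin
      binomialSum t (suc n) f
    ≈⟨ sumTo-cong′ (suc n) pascal ⟩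
      sumTo (suc n) (λ k → lower k + upper k)
    ≈⟨ sumTo-+ (suc n) lower upper ⟩
      sumTo (suc n) lower + sumTo (suc n) upper
    ≈⟨ +-cong (sumTo-dropLast n lower lower-top) (trans (sumTo-peel n upper) (+-identityˡ _)) ⟩
      sumTo n lower + binomialSum t n (λ k → f (suc k))
    ≈⟨ +-cong (trans (sumTo-cong n lower≈) (sumTo-*ˡ n t _)) refl ⟩
      t * binomialSum t n f + binomialSum t n (λ k → f (suc k))
    ∎
    where
    -- the two halves of C(n+1,k) = C(n,k) + C(n,k-1)
    lower upper : ℕ → Carrier
    lower k = binom n k * t ^ (suc n ℕ.∸ k) * f k
    upper zero    = 0#
    upper (suc k) = binom n k * t ^ (n ℕ.∸ k) * f (suc k)

    pascal : ∀ k → binom (suc n) k * t ^ (suc n ℕ.∸ k) * f k ≈ lower k + upper k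
    pascal zero    = sym (+-identityʳ _)
    pascal (suc k) = begin
        binom (suc n) (suc k) * p * f (suc k)
      ≈⟨ *-cong (*-cong (⟦≡⟧ (PE.sym (nCk+nC[k+1]≡[n+1]C[k+1] n k))) refl) refl ⟩
        ⟦ n C k ℕ.+ n C suc k ⟧ * p * f (suc k)
      ≈⟨ *-cong (*-cong (⟦+⟧ (n C k) (n C suc k)) refl) refl ⟩
        (binom n k + binom n (suc k)) * p * f (suc k)
      ≈⟨ solve 4 (λ a b p q → ((a :+ b) :* p :* q) := (b :* p :* q :+ a :* p :* q)) refl _ _ _ _ ⟩
        lower (suc k) + upper (suc k)
      ∎
      where p = t ^ (n ℕ.∸ k)

    lower-top : lower (suc n) ≈ 0#
    lower-top = trans (*-cong (*-cong (⟦≡⟧ (k>n⇒nCk≡0 (NP.n<1+n n))) refl) refl)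
                      (trans (*-cong (zeroˡ _) refl) (zeroˡ _))

    lower≈ : ∀ k → k ℕ.≤ n → lower k ≈ t * (binom n k * t ^ (n ℕ.∸ k) * f k)
    lower≈ k k≤n = begin
        binom n k * t ^ (suc n ℕ.∸ k) * f k
      ≡⟨ PE.cong (λ e → binom n k * t ^ e * f k) (NP.+-∸-assoc 1 k≤n) ⟩
        binom n k * (t * t ^ (n ℕ.∸ k)) * f k
      ≈⟨ solve 4 (λ a t p q → (a :* (t :* p) :* q) := (t :* (a :* p :* q))) refl _ _ _ _ ⟩
        t * (binom n k * t ^ (n ℕ.∸ k) * f k)
      ∎

  -- r-Bell polynomials at a fixed point x.  B s n stands for B_{n,s}(x).
  module AtPoint (x : Carrier) where

    B : Carrier → ℕ → Carrier
    B s n = rBellPoly n s x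

    B-cong : ∀ {s t} → s ≈ t → ∀ n → B s n ≈ B t n
    B-cong s≈t n = sumTo-cong′ n (λ k → *-cong (rStirling-cong s≈t n k) refl)

    B-suc : ∀ s n → B s (suc n) ≈ x * B (s + 1#) n + s * B s n
    B-suc s n = begin
        B s (suc n)
      ≈⟨ sumTo-peel n _ ⟩
        (0# + s) * S s n 0 * 1# + sumTo n (λ k → S s (suc n) (suc k) * x ^ suc k)
      ≈⟨ +-cong (*-cong (*-cong (+-identityˡ s) refl) refl) (sumTo-cong′ n split) ⟩
        s * S s n 0 * 1# + sumTo n (λ k → x * (S (s + 1#) n k * x ^ k) + s * upper k)
      ≈⟨ +-cong refl (sumTo-linear n x s _ upper) ⟩
        s * S s n 0 * 1# + (x * B (s + 1#) n + s * sumTo n upper)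
      ≈⟨ solve 6 (λ u s a₀ x b t → (s :* a₀ :* u :+ (x :* b :+ s :* t)) := (x :* b :+ s :* (a₀ :* u :+ t)))
           refl 1# s (S s n 0) x (B (s + 1#) n) (sumTo n upper) ⟩
        x * B (s + 1#) n + s * (S s n 0 * 1# + sumTo n upper)
      ≈⟨ +-cong refl (*-cong refl reassemble) ⟩
        x * B (s + 1#) n + s * B s n
      ∎
      where
      upper : ℕ → Carrier
      upper k = S s n (suc k) * x ^ suc k

      split : ∀ k → S s (suc n) (suc k) * x ^ suc k ≈ x * (S (s + 1#) n k * x ^ k) + s * upper k
      split k = trans (*-cong (rStirling-shift s n k) refl)
        (solve 5 (λ x s b a p → ((b :+ s :* a) :* (x :* p)) := (x :* (b :* p) :+ s :* (a :* (x :* p))))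
           refl x s (S (s + 1#) n k) (S s n (suc k)) (x ^ k))

      -- B_{n,s}(x) with its first term split off; the top term of degree n+1 is zero.
      reassemble : S s n 0 * 1# + sumTo n upper ≈ B s n
      reassemble = begin
          S s n 0 * 1# + sumTo n upper
        ≈⟨ sumTo-peel n (λ k → S s n k * x ^ k) ⟨
          sumTo (suc n) (λ k → S s n k * x ^ k)
        ≈⟨ sumTo-dropLast n _
             (trans (*-cong (rStirling-vanish s n (suc n) NP.≤-refl) refl) (zeroˡ _)) ⟩
          B s n
        ∎

    B-binomialShift : ∀ t n s → B (s + t) n ≈ binomialSum t n (B s)
    B-binomialShift t zero s = trans (*-identityˡ 1#) (sym (trans
      (*-cong (*-cong (+-identityʳ 1#) refl) (*-identityˡ 1#)) (trans (*-identityʳ _) (*-identityˡ 1#))))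
    B-binomialShift t (suc n) s = begin
        B (s + t) (suc n)
      ≈⟨ B-suc (s + t) n ⟩
        x * B ((s + t) + 1#) n + (s + t) * B (s + t) n
      ≈⟨ +-cong (*-cong refl (B-cong (solve 3 (λ u s t → ((s :+ t) :+ u) := ((s :+ u) :+ t)) refl 1# s t) n)) refl ⟩
        x * B ((s + 1#) + t) n + (s + t) * B (s + t) n
      ≈⟨ +-cong (*-cong refl (B-binomialShift t n (s + 1#))) (*-cong refl (B-binomialShift t n s)) ⟩
        x * U + (s + t) * V
      ≈⟨ solve 5 (λ x u s t v → (x :* u :+ (s :+ t) :* v) := (t :* v :+ (x :* u :+ s :* v))) refl x U s t V ⟩
        t * V + (x * U + s * V)
      ≈⟨ +-cong refl shifted ⟨
        t * V + binomialSum t n (λ k → B s (suc k))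
      ≈⟨ binomialSum-suc t n (B s) ⟨
        binomialSum t (suc n) (B s)
      ∎
      where
      U V : Carrier
      U = binomialSum t n (B (s + 1#))
      V = binomialSum t n (B s)

      shifted : binomialSum t n (λ k → B s (suc k)) ≈ x * U + s * V
      shifted = trans (sumTo-cong′ n (λ k → trans (*-cong refl (B-suc s k))
          (solve 5 (λ c x a s b → (c :* (x :* a :+ s :* b)) := (x :* (c :* a) :+ s :* (c :* b)))
             refl _ x _ s _)))
        (sumTo-linear n x s _ _)

    -- Expansion:  B_{n+l,r}(x) = Σ_j {l+r, j+r}_r x^j B_{n,r+j}(x),
    -- by induction on l, moving one unit from l to n via recurrence (1).
    B-expansion : ∀ r l n → B r (n ℕ.+ l) ≈ sumTo l (λ j → S r l j * x ^ j * B (r + ⟦ j ⟧) n)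
    B-expansion r zero n rewrite NP.+-identityʳ n =
      trans (B-cong (sym (+-identityʳ r)) n) (sym (trans (*-cong (*-identityˡ 1#) refl) (*-identityˡ _)))
    B-expansion r (suc l) n rewrite NP.+-suc n l = begin
        B r (suc n ℕ.+ l)
      ≈⟨ B-expansion r l (suc n) ⟩
        sumTo l (λ j → S r l j * x ^ j * B (r + ⟦ j ⟧) (suc n))
      ≈⟨ sumTo-cong′ l split ⟩
        sumTo l (λ j → raise j + keep j)
      ≈⟨ sumTo-+ l raise keep ⟩
        sumTo l raise + sumTo l keep
      ≈⟨ +-cong refl (sumTo-dropLast l keep keep-top) ⟨
        sumTo l raise + sumTo (suc l) keep
      ≈⟨ +-cong refl (sumTo-peel l keep) ⟩
        sumTo l raise + (keep 0 + sumTo l (λ j → keep (suc j)))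
      ≈⟨ solve 3 (λ f a b → (f :+ (a :+ b)) := (a :+ (f :+ b))) refl _ _ _ ⟩
        keep 0 + (sumTo l raise + sumTo l (λ j → keep (suc j)))
      ≈⟨ +-cong refl (trans (sym (sumTo-+ l raise (λ j → keep (suc j)))) (sumTo-cong′ l combine)) ⟩
        keep 0 + sumTo l (λ j → S r (suc l) (suc j) * x ^ suc j * Bᵣ (suc j))
      ≈⟨ sumTo-peel l _ ⟨
        sumTo (suc l) (λ j → S r (suc l) j * x ^ j * Bᵣ j)
      ∎
      where
      Bᵣ : ℕ → Carrier
      Bᵣ j = B (r + ⟦ j ⟧) n

      -- the two terms of recurrence (1) applied to B_{n+1,r+j}(x)
      raise keep : ℕ → Carrier
      raise j = S r l j * x ^ suc j * Bᵣ (suc j)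
      keep  j = (⟦ j ⟧ + r) * S r l j * x ^ j * Bᵣ j

      split : ∀ j → S r l j * x ^ j * B (r + ⟦ j ⟧) (suc n) ≈ raise j + keep j
      split j = begin
          S r l j * x ^ j * B (r + ⟦ j ⟧) (suc n)
        ≈⟨ *-cong refl (B-suc (r + ⟦ j ⟧) n) ⟩
          S r l j * x ^ j * (x * B ((r + ⟦ j ⟧) + 1#) n + (r + ⟦ j ⟧) * Bᵣ j)
        ≈⟨ *-cong refl (+-cong (*-cong refl (B-cong
             (solve 3 (λ u r k → ((r :+ k) :+ u) := (r :+ (u :+ k))) refl 1# r ⟦ j ⟧) n)) refl) ⟩
          S r l j * x ^ j * (x * Bᵣ (suc j) + (r + ⟦ j ⟧) * Bᵣ j)
        ≈⟨ solve 7 (λ a p x b′ r k b → (a :* p :* (x :* b′ :+ (r :+ k) :* b))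
              := (a :* (x :* p) :* b′ :+ (k :+ r) :* a :* p :* b)) refl _ _ x _ r _ _ ⟩
          raise j + keep j
        ∎

      -- regrouping by the Stirling recurrence {l+1+r, j+1+r} = {l+r, j+r} + (j+1+r){l+r, j+1+r}
      combine : ∀ j → raise j + keep (suc j) ≈ S r (suc l) (suc j) * x ^ suc j * Bᵣ (suc j)
      combine j = solve 5 (λ a b c p q → (a :* p :* q :+ b :* c :* p :* q) := ((a :+ b :* c) :* p :* q))
                    refl _ _ _ _ _

      keep-top : keep (suc l) ≈ 0#
      keep-top = trans (*-cong (*-cong (*-cong refl (rStirling-vanish r l (suc l) NP.≤-refl)) refl) refl)
        (trans (*-cong (*-cong (zeroʳ _) refl) refl) (trans (*-cong (zeroˡ _) refl) (zeroˡ _)))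

    B-convolution : ∀ n l r → B r (n ℕ.+ l)
      ≈ sumTo l (λ j → sumTo n (λ k →
          S r l j * binom n k * natPow j (n ℕ.∸ k) * B r k * (x ^ j)))
    B-convolution n l r = trans (B-expansion r l n) (sumTo-cong′ l λ j → begin
        S r l j * x ^ j * B (r + ⟦ j ⟧) n
      ≈⟨ *-cong refl (B-binomialShift ⟦ j ⟧ n r) ⟩
        S r l j * x ^ j * binomialSum ⟦ j ⟧ n (B r)
      ≈⟨ sumTo-*ˡ n _ _ ⟨
        sumTo n (λ k → S r l j * x ^ j * (binom n k * natPow j (n ℕ.∸ k) * B r k))
      ≈⟨ sumTo-cong′ n (λ k → solve 5 (λ a p b q c → (a :* p :* (b :* q :* c)) := (a :* b :* q :* c :* p))
           refl _ _ _ _ _) ⟩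
        sumTo n (λ k → S r l j * binom n k * natPow j (n ℕ.∸ k) * B r k * (x ^ j))
      ∎)

  1^ : ∀ j → 1# ^ j ≈ 1#
  1^ zero    = refl
  1^ (suc j) = trans (*-cong refl (1^ j)) (*-identityˡ _)

corollary3 : ∀ {c ℓ : Level} (R : CommutativeRing c ℓ) →
    let open CommutativeRing R in
    let open RBell R in
    (n l : ℕ) (r x : Carrier) →
      (rBellPoly (n ℕ.+ l) r x
        ≈ sumTo l (λ j → sumTo n (λ k →
            rStirling r l j * binom n k * natPow j (n ℕ.∸ k) * rBellPoly k r x * (x ^ j))))
      P.× (rBell (n ℕ.+ l) r
        ≈ sumTo l (λ j → sumTo n (λ k →
            rStirling r l j * binom n k * natPow j (n ℕ.∸ k) * rBell k r)))
corollary3 R n l r x =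
  AtPoint.B-convolution x n l r P.,
  trans (AtPoint.B-convolution 1# n l r)
        (sumTo-cong′ l (λ j → sumTo-cong′ n (λ k → trans (*-cong refl (1^ j)) (*-identityʳ _))))
  where
  open CommutativeRing R using (1#; trans; refl; *-cong; *-identityʳ)
  open RBellIdentities R
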